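{- Let $P$ be a poset, let $\mathcal{S} = \{S_x : x \in P\}$ be an inclusion representation of $P$, and let $y \in P$. Let $Q = P - D_P[y]$, and let $Q'$ be a poset with the ground set $\{S_x-S_y : x \in Q\}$ ordered by inclusion. Let $\varepsilon \in \{0,1\}$ be the number of unique minimal elements of $Q'$. Then, there exists an inclusion representation $\mathcal{S}' = \{S_x' : x \in P\}$ of $P$ with $|S_x'| \leq |S_x|$ for every $x \in P$ and $\left|\bigcup\mathcal{S}'\right| \leq \operatorname{iir}(Q') + \varepsilon + |S_y|$.
   Context: All posets are finite; subposets may be empty (with $\operatorname{iir}$ of the empty poset being $0$). An inclusion representation of $P$ is a family $\{S_x:x\in P\}$ with $x\le y$ iff $S_x\subseteq S_y$. $D_P[y]=\{u\in P:u\le y\}$. For inclusion representations $\mathcal{S},\mathcal{S}'$ of a poset, $\mathcal{S}$ is a reduction of $\mathcal{S}'$ if $|\bigcup\mathcal{S}|\le|\bigcup\mathcal{S}'|$ and $|S_x|\le|S'_x|$ for all $x$; a strict reduction if additionally $\mathcal{S}'$ is not a reduction of $\mathcal{S}$; irreducible if it has no strict reduction. $\operatorname{iir}(R)$ denotes the maximum size of the ground set of an irreducible inclusion representation of the poset $R$. -}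

module Defs where

open import Level using (0ℓ)
open import Data.Nat using (ℕ; _≤_)
open import Data.Fin using (Fin)
open import Data.Fin.Subset using (Subset; _⊆_; ⋃; ∣_∣; _─_)
open import Data.List using (tabulate)
open import Data.Product using (Σ; ∃; _×_; _,_)
open import Data.Sum using (_⊎_)
open import Relation.Nullary using (¬_)
open import Relation.Binary.PropositionalEquality using (_≡_)
open import Function.Bundles using (_⇔_)

-- Finite sets S_x are modelled as subsets of Fin n (any finite family of
-- finite sets can be relabelled into some Fin n without changing sizes).

Union : ∀ {p n} → (Fin p → Subset n) → Subset n
Union S = ⋃ (tabulate S)

IsInclRep : ∀ {r} (_≤R_ : Fin r → Fin r → Set) {n} → (Fin r → Subset n) → Set
IsInclRep {r} _≤R_ S = ∀ (x y : Fin r) → (x ≤R y) ⇔ (S x ⊆ S y)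

IsReduction : ∀ {r n n'} → (Fin r → Subset n) → (Fin r → Subset n') → Set
IsReduction S S' = (∣ Union S ∣ ≤ ∣ Union S' ∣) × (∀ x → ∣ S x ∣ ≤ ∣ S' x ∣)

IsStrictReduction : ∀ {r n n'} → (Fin r → Subset n) → (Fin r → Subset n') → Set
IsStrictReduction S S' = IsReduction S S' × ¬ IsReduction S' S

IsIrreducible : ∀ {r} (_≤R_ : Fin r → Fin r → Set) {n} → (Fin r → Subset n) → Set
IsIrreducible {r} _≤R_ S =
  ∀ (n' : ℕ) (S' : Fin r → Subset n') → IsInclRep _≤R_ S' → ¬ IsStrictReduction S' S

IsIIR : ∀ {r} (_≤R_ : Fin r → Fin r → Set) → ℕ → Set
IsIIR {r} _≤R_ k =
  (Σ ℕ λ n → Σ (Fin r → Subset n) λ S →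
     IsInclRep _≤R_ S × IsIrreducible _≤R_ S × ∣ Union S ∣ ≡ k)
  × (∀ (n : ℕ) (S : Fin r → Subset n) →
       IsInclRep _≤R_ S → IsIrreducible _≤R_ S → ∣ Union S ∣ ≤ k)

IsMinimal : ∀ {r} (_≤R_ : Fin r → Fin r → Set) → Fin r → Set
IsMinimal {r} _≤R_ a = ∀ (b : Fin r) → b ≤R a → b ≡ a

HasUniqueMinimal : ∀ {r} (_≤R_ : Fin r → Fin r → Set) → Set
HasUniqueMinimal {r} _≤R_ =
  Σ (Fin r) λ a → IsMinimal _≤R_ a × (∀ b → IsMinimal _≤R_ b → b ≡ a)

IsEpsilon : ∀ {r} (_≤R_ : Fin r → Fin r → Set) → ℕ → Set
IsEpsilon _≤R_ ε =
  (ε ≡ 1 × HasUniqueMinimal _≤R_) ⊎ (ε ≡ 0 × ¬ HasUniqueMinimal _≤R_)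

-- e : Fin q → Subset n enumerates (without repetition) exactly the set
-- { S x ─ S y : x ∈ P, ¬ (x ≤ y) }, i.e. the ground set of Q'
EnumeratesQ' : ∀ {p n q} (_≤P_ : Fin p → Fin p → Set) (S : Fin p → Subset n)
  (y : Fin p) (e : Fin q → Subset n) → Set
EnumeratesQ' {p} {n} {q} _≤P_ S y e =
  (∀ (a b : Fin q) → e a ≡ e b → a ≡ b)
  × (∀ (a : Fin q) → Σ (Fin p) λ x → ¬ (x ≤P y) × e a ≡ (S x ─ S y))
  × (∀ (x : Fin p) → ¬ (x ≤P y) → Σ (Fin q) λ a → e a ≡ (S x ─ S y))

Q'Order : ∀ {q n} → (Fin q → Subset n) → Fin q → Fin q → Set
Q'Order e a b = e a ⊆ e b

-- Split every S x into its inner part S x ∩ S y and its outer part S x ─ S y: one set is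
-- included in another iff both parts are. The nonempty outer parts are exactly the sets of
-- Q', so they can be replaced by the sets of an irreducible representation of Q' (whose
-- ground set has at most iir(Q') points), and the empty ones by ∅, provided no replacement
-- set is empty. If Q' has no least element this is automatic, since an empty set would be
-- least. If it has a least set L, represent Q' by the sets with L removed instead and add
-- one fresh point to all of them; this costs ε = 1.
-- Irreducible reductions exist because a strict reduction decreases |⋃S| + Σ|S x|, and
-- whether one exists is decidable: any strict reduction can be compressed into the
-- ground set of the representation it reduces.
{-# OPTIONS --safe #-}
module Submission where

open import Defs
open import Level using (0ℓ)
open import Data.Nat using (ℕ; zero; suc; _≤_; _<_; _+_; z≤n; s≤s; _≤?_)
open import Data.Nat.Properties
open import Data.Fin using (Fin; zero; suc)
open import Data.Fin.Subset
open import Data.Fin.Subset.Properties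
open import Data.Fin.Properties using (any?; all?; ¬∀⟶∃¬)
open import Data.Vec using (Vec; []; _∷_; _++_; lookup; tabulate; here; there)
open import Data.Vec.Properties using (lookup∘tabulate)
import Data.List.Properties as List
open import Data.Product using (Σ; ∃; _×_; _,_; proj₁; proj₂; uncurry)
open import Data.Product.Function.NonDependent.Propositional using (_×-⇔_)
open import Data.Sum using (inj₁; inj₂)
open import Data.Empty using (⊥-elim)
open import Function.Base using (_∘_; _on_)
open import Function.Bundles using (_⇔_; mk⇔; Equivalence)
import Function.Properties.Equivalence as ⇔
open import Data.Nat.Induction using (<-wellFounded)
open import Induction.WellFounded using (Acc; acc)
import Relation.Binary.Construct.On as On
import Relation.Binary.Reasoning.Setoid as SetoidReasoning
open import Relation.Nullary using (¬_; Dec; yes; no; contradiction)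
open import Relation.Nullary.Decidable using (_×-dec_; _→-dec_; ¬?; map′; decidable-stable)
open import Relation.Binary.PropositionalEquality
  using (_≡_; _≗_; refl; sym; trans; cong; cong₂; subst; subst₂; module ≡-Reasoning)
open import Relation.Binary.Structures using (IsPartialOrder)
open import Algebra.Properties.Monoid.Sum +-0-monoid using (sum)

open Equivalence using (to; from)

x∈p─q⇒x∉q : ∀ {n} {x : Fin n} (p q : Subset n) → x ∈ p ─ q → x ∉ q
x∈p─q⇒x∉q (_ ∷ p) (inside  ∷ q) ()         here
x∈p─q⇒x∉q (_ ∷ p) (outside ∷ q) here       ()
x∈p─q⇒x∉q (_ ∷ p) (_       ∷ q) (there x∈p─q) (there x∈q) = x∈p─q⇒x∉q p q x∈p─q x∈q

∣p─q∣+∣p∩q∣≡∣p∣ : ∀ {n} (p q : Subset n) → ∣ p ─ q ∣ + ∣ p ∩ q ∣ ≡ ∣ p ∣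
∣p─q∣+∣p∩q∣≡∣p∣ []            []            = refl
∣p─q∣+∣p∩q∣≡∣p∣ (inside  ∷ p) (inside  ∷ q) = trans (+-suc _ _) (cong suc (∣p─q∣+∣p∩q∣≡∣p∣ p q))
∣p─q∣+∣p∩q∣≡∣p∣ (inside  ∷ p) (outside ∷ q) = cong suc (∣p─q∣+∣p∩q∣≡∣p∣ p q)
∣p─q∣+∣p∩q∣≡∣p∣ (outside ∷ p) (inside  ∷ q) = ∣p─q∣+∣p∩q∣≡∣p∣ p q
∣p─q∣+∣p∩q∣≡∣p∣ (outside ∷ p) (outside ∷ q) = ∣p─q∣+∣p∩q∣≡∣p∣ p q

∣p++q∣≡∣p∣+∣q∣ : ∀ {m n} (p : Subset m) (q : Subset n) → ∣ p ++ q ∣ ≡ ∣ p ∣ + ∣ q ∣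
∣p++q∣≡∣p∣+∣q∣ []            q = refl
∣p++q∣≡∣p∣+∣q∣ (inside  ∷ p) q = cong suc (∣p++q∣≡∣p∣+∣q∣ p q)
∣p++q∣≡∣p∣+∣q∣ (outside ∷ p) q = ∣p++q∣≡∣p∣+∣q∣ p q

∷⊆∷ : ∀ {m n s t} {p q : Subset m} {p′ q′ : Subset n} → s ∷ p ⊆ t ∷ q → p′ ⊆ q′ → s ∷ p′ ⊆ t ∷ q′
∷⊆∷ sp⊆tq _ here with sp⊆tq here
... | here = here
∷⊆∷ _ p′⊆q′ (there x∈p′) = there (p′⊆q′ x∈p′)

++⊆++⁺ : ∀ {m n} {p q : Subset m} {p′ q′ : Subset n} → p ⊆ q → p′ ⊆ q′ → p ++ p′ ⊆ q ++ q′
++⊆++⁺ {p = []}    {[]}    _   p′⊆q′ = p′⊆q′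
++⊆++⁺ {p = _ ∷ _} {_ ∷ _} p⊆q p′⊆q′ = ∷⊆∷ p⊆q (++⊆++⁺ (drop-∷-⊆ p⊆q) p′⊆q′)

++⊆++⁻ˡ : ∀ {m n} {p q : Subset m} {p′ q′ : Subset n} → p ++ p′ ⊆ q ++ q′ → p ⊆ q
++⊆++⁻ˡ {p = []}    {[]}    _ ()
++⊆++⁻ˡ {p = _ ∷ _} {_ ∷ _} h = ∷⊆∷ h (++⊆++⁻ˡ (drop-∷-⊆ h))

++⊆++⁻ʳ : ∀ {m n} {p q : Subset m} {p′ q′ : Subset n} → p ++ p′ ⊆ q ++ q′ → p′ ⊆ q′
++⊆++⁻ʳ {p = []}    {[]}    h = h
++⊆++⁻ʳ {p = _ ∷ _} {_ ∷ _} h = ++⊆++⁻ʳ (drop-∷-⊆ h)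

++⊆++⇔ : ∀ {m n} {p q : Subset m} {p′ q′ : Subset n} → p ++ p′ ⊆ q ++ q′ ⇔ (p ⊆ q × p′ ⊆ q′)
++⊆++⇔ {p = p} {q} {p′} {q′} = mk⇔ split (uncurry ++⊆++⁺)
  where
  split : p ++ p′ ⊆ q ++ q′ → p ⊆ q × p′ ⊆ q′
  split h = ++⊆++⁻ˡ h , ++⊆++⁻ʳ h

⊆⇔─×∩ : ∀ {n} (p q r : Subset n) → p ⊆ q ⇔ (p ─ r ⊆ q ─ r × p ∩ r ⊆ q ∩ r)
⊆⇔─×∩ p q r = mk⇔ split glue
  where
  ─-mono : p ⊆ q → p ─ r ⊆ q ─ r
  ─-mono p⊆q x∈p─r = x∈p∧x∉q⇒x∈p─q (p⊆q (p─q⊆p p r x∈p─r)) (x∈p─q⇒x∉q p r x∈p─r)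
  ∩-mono : p ⊆ q → p ∩ r ⊆ q ∩ r
  ∩-mono p⊆q x∈p∩r with x∈p∩q⁻ p r x∈p∩r
  ... | x∈p , x∈r = x∈p∩q⁺ (p⊆q x∈p , x∈r)
  split : p ⊆ q → p ─ r ⊆ q ─ r × p ∩ r ⊆ q ∩ r
  split p⊆q = ─-mono p⊆q , ∩-mono p⊆q
  glue : (p ─ r ⊆ q ─ r × p ∩ r ⊆ q ∩ r) → p ⊆ q
  glue (outer , inner) {x} x∈p with x ∈? r
  ... | yes x∈r = proj₁ (x∈p∩q⁻ q r (inner (x∈p∩q⁺ (x∈p , x∈r))))
  ... | no  x∉r = p─q⊆p q r (outer (x∈p∧x∉q⇒x∈p─q x∈p x∉r))

─⊆─⇔⊆ : ∀ {n} (p q r : Subset n) → r ⊆ q → (p ─ r ⊆ q ─ r) ⇔ p ⊆ q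
─⊆─⇔⊆ p q r r⊆q = mk⇔ reflect preserve
  where
  inner : p ∩ r ⊆ q ∩ r
  inner x∈p∩r with x∈p∩q⁻ p r x∈p∩r
  ... | _ , x∈r = x∈p∩q⁺ (r⊆q x∈r , x∈r)
  reflect : p ─ r ⊆ q ─ r → p ⊆ q
  reflect outer = from (⊆⇔─×∩ p q r) (outer , inner)
  preserve : p ⊆ q → p ─ r ⊆ q ─ r
  preserve p⊆q = proj₁ (to (⊆⇔─×∩ p q r) p⊆q)

∣p++q∩r∣≤∣q∣ : ∀ {m n} (p : Subset m) (q r : Subset n) → ∣ p ∣ ≤ ∣ q ─ r ∣ → ∣ p ++ q ∩ r ∣ ≤ ∣ q ∣
∣p++q∩r∣≤∣q∣ p q r ∣p∣≤ = begin
  ∣ p ++ q ∩ r ∣        ≡⟨ ∣p++q∣≡∣p∣+∣q∣ p (q ∩ r) ⟩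
  ∣ p ∣ + ∣ q ∩ r ∣     ≤⟨ +-monoˡ-≤ ∣ q ∩ r ∣ ∣p∣≤ ⟩
  ∣ q ─ r ∣ + ∣ q ∩ r ∣ ≡⟨ ∣p─q∣+∣p∩q∣≡∣p∣ q r ⟩
  ∣ q ∣                 ∎
  where open ≤-Reasoning

Empty⇒⊆ : ∀ {n} {p q : Subset n} → Empty p → p ⊆ q
Empty⇒⊆ empty x∈p = contradiction (_ , x∈p) empty

Nonempty⇒⊈Empty : ∀ {n} {p q : Subset n} → Nonempty p → Empty q → p ⊈ q
Nonempty⇒⊈Empty (_ , x∈p) empty p⊆q = empty (_ , p⊆q x∈p)

Empty⇒⊆⇔⊆ : ∀ {m n} {p q : Subset m} {p′ q′ : Subset n} → Empty p → Empty p′ → p ⊆ q ⇔ p′ ⊆ q′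
Empty⇒⊆⇔⊆ {p = p} {q} {p′} {q′} empty empty′ = mk⇔ p′⊆q′ p⊆q
  where
  p⊆q : p′ ⊆ q′ → p ⊆ q
  p⊆q _ = Empty⇒⊆ empty
  p′⊆q′ : p ⊆ q → p′ ⊆ q′
  p′⊆q′ _ = Empty⇒⊆ empty′

Empty⊥ : ∀ {n} → Empty (⊥ {n})
Empty⊥ (_ , x∈⊥) = ∉⊥ x∈⊥

⊆⇒Empty─ : ∀ {n} {p q : Subset n} → p ⊆ q → Empty (p ─ q)
⊆⇒Empty─ {p = p} {q} p⊆q (_ , x∈p─q) = x∈p─q⇒x∉q p q x∈p─q (p⊆q (p─q⊆p p q x∈p─q))

⊈⇒Nonempty─ : ∀ {n} {p q : Subset n} → p ⊈ q → Nonempty (p ─ q)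
⊈⇒Nonempty─ {p = p} {q} p⊈q with nonempty? (p ─ q)
... | yes nonempty = nonempty
... | no  empty    = ⊥-elim (p⊈q p⊆q)
  where
  p⊆q : p ⊆ q
  p⊆q {x} x∈p = decidable-stable (x ∈? q) (λ x∉q → empty (x , x∈p∧x∉q⇒x∈p─q x∈p x∉q))

⊆-Union : ∀ {r n} (S : Fin r → Subset n) x → S x ⊆ Union S
⊆-Union S zero    x∈ = p⊆p∪q _ x∈
⊆-Union S (suc x) x∈ = q⊆p∪q (S zero) _ (⊆-Union (S ∘ suc) x x∈)

Union-⊆ : ∀ {r n} (S : Fin r → Subset n) {q} → (∀ x → S x ⊆ q) → Union S ⊆ q
Union-⊆ {zero}  S _   x∈ = contradiction x∈ ∉⊥
Union-⊆ {suc r} S S⊆q x∈ with x∈p∪q⁻ (S zero) _ x∈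
... | inj₁ x∈S₀   = S⊆q zero x∈S₀
... | inj₂ x∈rest = Union-⊆ (S ∘ suc) (S⊆q ∘ suc) x∈rest

Union-cong : ∀ {r n} {S T : Fin r → Subset n} → S ≗ T → Union S ≡ Union T
Union-cong S≗T = cong ⋃ (List.tabulate-cong S≗T)

∣Union∣≤ : ∀ {r n} (S : Fin r → Subset n) {q} → (∀ x → S x ⊆ q) → ∣ Union S ∣ ≤ ∣ q ∣
∣Union∣≤ S S⊆q = p⊆q⇒∣p∣≤∣q∣ (Union-⊆ S S⊆q)

sum-mono-≤ : ∀ {r} {f g : Fin r → ℕ} → (∀ x → f x ≤ g x) → sum f ≤ sum g
sum-mono-≤ {zero}  _   = z≤n
sum-mono-≤ {suc r} f≤g = +-mono-≤ (f≤g zero) (sum-mono-≤ (f≤g ∘ suc))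

sum-mono-< : ∀ {r} {f g : Fin r → ℕ} → (∀ x → f x ≤ g x) → ∀ x → f x < g x → sum f < sum g
sum-mono-< {suc r} f≤g zero    f<g = +-mono-<-≤ f<g (sum-mono-≤ (f≤g ∘ suc))
sum-mono-< {suc r} f≤g (suc x) f<g = +-mono-≤-< (f≤g zero) (sum-mono-< (f≤g ∘ suc) x f<g)

weight : ∀ {r n} → (Fin r → Subset n) → ℕ
weight S = ∣ Union S ∣ + sum (λ x → ∣ S x ∣)

IsStrictReduction⇒weight< : ∀ {r n n′} {S : Fin r → Subset n} {T : Fin r → Subset n′} →
  IsStrictReduction S T → weight S < weight T
IsStrictReduction⇒weight< {r} {S = S} {T} ((∣⋃S∣≤ , ∣S∣≤) , ¬T≼S) with ∣ Union T ∣ ≤? ∣ Union S ∣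
... | no  ∣⋃T∣≰ = +-mono-<-≤ (≰⇒> ∣⋃T∣≰) (sum-mono-≤ ∣S∣≤)
... | yes ∣⋃T∣≤ with ¬∀⟶∃¬ r _ (λ x → ∣ T x ∣ ≤? ∣ S x ∣) (λ ∣T∣≤ → ¬T≼S (∣⋃T∣≤ , ∣T∣≤))
...   | x , ∣Tx∣≰ = +-mono-≤-< ∣⋃S∣≤ (sum-mono-< ∣S∣≤ x (≰⇒> ∣Tx∣≰))

¬⇒⇔ : ∀ {A B : Set} → ¬ A → ¬ B → A ⇔ B
¬⇒⇔ ¬a ¬b = mk⇔ (⊥-elim ∘ ¬a) (⊥-elim ∘ ¬b)

_⇔?_ : ∀ {A B : Set} → Dec A → Dec B → Dec (A ⇔ B)
A? ⇔? B? = map′ (uncurry mk⇔) (λ A⇔B → to A⇔B , from A⇔B) ((A? →-dec B?) ×-dec (B? →-dec A?))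

IsInclRep⇒Decidable : ∀ {r} {R : Fin r → Fin r → Set} {n} {T : Fin r → Subset n} →
  IsInclRep R T → ∀ a b → Dec (R a b)
IsInclRep⇒Decidable {T = T} rep a b = map′ (from (rep a b)) (to (rep a b)) (T a ⊆? T b)

IsInclRep? : ∀ {r} {R : Fin r → Fin r → Set} → (∀ a b → Dec (R a b)) →
  ∀ {n} (T : Fin r → Subset n) → Dec (IsInclRep R T)
IsInclRep? R? T = all? λ a → all? λ b → R? a b ⇔? (T a ⊆? T b)

IsReduction? : ∀ {r n n′} (S : Fin r → Subset n) (T : Fin r → Subset n′) → Dec (IsReduction S T)
IsReduction? S T = (∣ Union S ∣ ≤? ∣ Union T ∣) ×-dec all? (λ x → ∣ S x ∣ ≤? ∣ T x ∣)

IsStrictReduction? : ∀ {r n n′} (S : Fin r → Subset n) (T : Fin r → Subset n′) → Dec (IsStrictReduction S T)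
IsStrictReduction? S T = IsReduction? S T ×-dec ¬? (IsReduction? T S)

anySubsetVec? : ∀ {n} r {P : Vec (Subset n) r → Set} → (∀ v → Dec (P v)) → Dec (∃ P)
anySubsetVec? zero    P? = map′ ([] ,_) (λ { ([] , p) → p }) (P? [])
anySubsetVec? (suc r) P? = map′ (λ (s , v , p) → s ∷ v , p) (λ { (s ∷ v , p) → s , v , p })
  (anySubset? λ s → anySubsetVec? r (P? ∘ (s ∷_)))

record Compression {r m n} (S : Fin r → Subset m) (T : Fin r → Subset n) : Set where
  field
    size-≡    : ∀ x → ∣ T x ∣ ≡ ∣ S x ∣
    ⊆-⇔       : ∀ x z → T x ⊆ T z ⇔ S x ⊆ S z
    ∣Union∣-≤ : ∣ Union T ∣ ≤ ∣ Union S ∣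

module _ {r m n} {S : Fin r → Subset m} {T : Fin r → Subset n} (c : Compression S T) where
  open Compression c

  Compression⇒IsInclRep : ∀ {R : Fin r → Fin r → Set} → IsInclRep R S → IsInclRep R T
  Compression⇒IsInclRep rep x z = ⇔.trans (rep x z) (⇔.sym (⊆-⇔ x z))

  Compression⇒IsStrictReduction : ∀ {n′} {W : Fin r → Subset n′} →
    IsStrictReduction S W → IsStrictReduction T W
  Compression⇒IsStrictReduction ((∣⋃S∣≤ , ∣S∣≤) , ¬W≼S) =
    (≤-trans ∣Union∣-≤ ∣⋃S∣≤ , λ x → ≤-trans (≤-reflexive (size-≡ x)) (∣S∣≤ x)) ,
    λ (∣⋃W∣≤ , ∣W∣≤) → ¬W≼S (≤-trans ∣⋃W∣≤ ∣Union∣-≤ , λ x → ≤-trans (∣W∣≤ x) (≤-reflexive (size-≡ x)))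

  Compression-≗ : ∀ {T′ : Fin r → Subset n} → T ≗ T′ → Compression S T′
  Compression-≗ T≗T′ = record
    { size-≡    = λ x → trans (cong ∣_∣ (sym (T≗T′ x))) (size-≡ x)
    ; ⊆-⇔       = λ x z → subst₂ (λ a b → a ⊆ b ⇔ _) (T≗T′ x) (T≗T′ z) (⊆-⇔ x z)
    ; ∣Union∣-≤ = subst (λ u → ∣ u ∣ ≤ _) (Union-cong T≗T′) ∣Union∣-≤
    }

restrict : ∀ {n} (u : Subset n) → Subset n → Subset ∣ u ∣
restrict []            []      = []
restrict (inside  ∷ u) (s ∷ p) = s ∷ restrict u p
restrict (outside ∷ u) (_ ∷ p) = restrict u p

∣restrict∣ : ∀ {n} (u p : Subset n) → p ⊆ u → ∣ restrict u p ∣ ≡ ∣ p ∣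
∣restrict∣ []            []            _   = refl
∣restrict∣ (inside  ∷ u) (inside  ∷ p) p⊆u = cong suc (∣restrict∣ u p (drop-∷-⊆ p⊆u))
∣restrict∣ (inside  ∷ u) (outside ∷ p) p⊆u = ∣restrict∣ u p (drop-∷-⊆ p⊆u)
∣restrict∣ (outside ∷ u) (inside  ∷ p) p⊆u = contradiction (p⊆u here) λ ()
∣restrict∣ (outside ∷ u) (outside ∷ p) p⊆u = ∣restrict∣ u p (drop-∷-⊆ p⊆u)

restrict-mono : ∀ {n} (u : Subset n) {p q} → p ⊆ q → restrict u p ⊆ restrict u q
restrict-mono []            {[]}    {[]}    p⊆q = p⊆q
restrict-mono (inside  ∷ u) {_ ∷ _} {_ ∷ _} p⊆q = ∷⊆∷ p⊆q (restrict-mono u (drop-∷-⊆ p⊆q))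
restrict-mono (outside ∷ u) {_ ∷ _} {_ ∷ _} p⊆q = restrict-mono u (drop-∷-⊆ p⊆q)

restrict-reflects-⊆ : ∀ {n} (u : Subset n) {p q} → p ⊆ u → restrict u p ⊆ restrict u q → p ⊆ q
restrict-reflects-⊆ []            {[]}          {[]}    _   h = h
restrict-reflects-⊆ (inside  ∷ u) {_ ∷ _}       {_ ∷ _} p⊆u h =
  ∷⊆∷ h (restrict-reflects-⊆ u (drop-∷-⊆ p⊆u) (drop-∷-⊆ h))
restrict-reflects-⊆ (outside ∷ u) {inside  ∷ _} {_ ∷ _} p⊆u h = contradiction (p⊆u here) λ ()
restrict-reflects-⊆ (outside ∷ u) {outside ∷ _} {_ ∷ _} p⊆u h =
  out⊆ (restrict-reflects-⊆ u (drop-∷-⊆ p⊆u) h)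

compress : ∀ {r m} (S : Fin r → Subset m) {N} → ∣ Union S ∣ ≤ N → Σ (Fin r → Subset N) (Compression S)
compress {r} {m} S ∣⋃S∣≤N with m≤n⇒∃[o]m+o≡n ∣⋃S∣≤N
... | d , refl = T , record { size-≡ = size-≡ ; ⊆-⇔ = ⊆-⇔ ; ∣Union∣-≤ = ∣Union∣-≤ }
  where
  u : Subset m
  u = Union S
  T : Fin r → Subset (∣ u ∣ + d)
  T x = restrict u (S x) ++ ⊥
  size-≡ : ∀ x → ∣ T x ∣ ≡ ∣ S x ∣
  size-≡ x = begin
    ∣ T x ∣                           ≡⟨ ∣p++q∣≡∣p∣+∣q∣ (restrict u (S x)) ⊥ ⟩
    ∣ restrict u (S x) ∣ + ∣ ⊥ {d} ∣  ≡⟨ cong₂ _+_ (∣restrict∣ u (S x) (⊆-Union S x)) (∣⊥∣≡0 d) ⟩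
    ∣ S x ∣ + 0                       ≡⟨ +-identityʳ _ ⟩
    ∣ S x ∣                           ∎
    where open ≡-Reasoning
  ⊆-⇔ : ∀ x z → T x ⊆ T z ⇔ S x ⊆ S z
  ⊆-⇔ x z = mk⇔ reflect preserve
    where
    reflect : T x ⊆ T z → S x ⊆ S z
    reflect h = restrict-reflects-⊆ u (⊆-Union S x) (++⊆++⁻ˡ h)
    preserve : S x ⊆ S z → T x ⊆ T z
    preserve h = ++⊆++⁺ (restrict-mono u h) ⊆-refl
  ∣Union∣-≤ : ∣ Union T ∣ ≤ ∣ u ∣
  ∣Union∣-≤ = begin
    ∣ Union T ∣            ≤⟨ ∣Union∣≤ T (λ x → ++⊆++⁺ {p = restrict u (S x)} {⊤} ⊆⊤ ⊆-refl) ⟩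
    ∣ ⊤ {∣ u ∣} ++ ⊥ {d} ∣ ≡⟨ ∣p++q∣≡∣p∣+∣q∣ (⊤ {∣ u ∣}) (⊥ {d}) ⟩
    ∣ ⊤ {∣ u ∣} ∣ + ∣ ⊥ {d} ∣ ≡⟨ cong₂ _+_ (∣⊤∣≡n ∣ u ∣) (∣⊥∣≡0 d) ⟩
    ∣ u ∣ + 0              ≡⟨ +-identityʳ _ ⟩
    ∣ u ∣                  ∎
    where open ≤-Reasoning

module _ {r} {R : Fin r → Fin r → Set} {n : ℕ} where

  -- Candidates are vectors, so that they can be searched exhaustively.
  StrictReductionOver : (Fin r → Subset n) → Set
  StrictReductionOver T =
    ∃ λ (v : Vec (Subset n) r) → IsInclRep R (lookup v) × IsStrictReduction (lookup v) T

  ¬StrictReductionOver⇒IsIrreducible : ∀ T → ¬ StrictReductionOver T → IsIrreducible R T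
  ¬StrictReductionOver⇒IsIrreducible T none n′ S′ rep′ strict
    with compress S′ (≤-trans (proj₁ (proj₁ strict)) (∣p∣≤n (Union T)))
  ... | T′ , S′↠T′ =
    none (tabulate T′ , Compression⇒IsInclRep c rep′ , Compression⇒IsStrictReduction c strict)
    where
    c : Compression S′ (lookup (tabulate T′))
    c = Compression-≗ S′↠T′ (λ x → sym (lookup∘tabulate T′ x))

  IrreducibleReduction : (Fin r → Subset n) → Set
  IrreducibleReduction T₀ =
    Σ (Fin r → Subset n) λ T → IsInclRep R T × IsIrreducible R T × (∀ x → ∣ T x ∣ ≤ ∣ T₀ x ∣)

  irreducibleReduction : ∀ {T₀ : Fin r → Subset n} → IsInclRep R T₀ → IrreducibleReduction T₀
  irreducibleReduction {T₀} rep₀ = descend T₀ (On.wellFounded weight <-wellFounded T₀) rep₀ (λ _ → ≤-refl)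
    where
    R? : ∀ a b → Dec (R a b)
    R? = IsInclRep⇒Decidable rep₀
    descend : ∀ T → Acc (_<_ on weight) T → IsInclRep R T → (∀ x → ∣ T x ∣ ≤ ∣ T₀ x ∣) →
      IrreducibleReduction T₀
    descend T (acc smaller) rep T≤T₀
      with anySubsetVec? r (λ v → IsInclRep? R? (lookup v) ×-dec IsStrictReduction? (lookup v) T)
    ... | yes (v , rep′ , strict@((_ , ∣v∣≤) , _)) =
      descend (lookup v) (smaller (IsStrictReduction⇒weight< strict)) rep′ (λ x → ≤-trans (∣v∣≤ x) (T≤T₀ x))
    ... | no none = T , rep , ¬StrictReductionOver⇒IsIrreducible T none , T≤T₀

IsInclRep-─ : ∀ {r} {R : Fin r → Fin r → Set} {n} {T : Fin r → Subset n} {c} →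
  (∀ a → c ⊆ T a) → IsInclRep R T → IsInclRep R (λ a → T a ─ c)
IsInclRep-─ {T = T} {c} c⊆T rep a b = ⇔.trans (rep a b) (⇔.sym (─⊆─⇔⊆ (T a) (T b) c (c⊆T b)))

IsInclRep-inside∷ : ∀ {r} {R : Fin r → Fin r → Set} {n} {T : Fin r → Subset n} →
  IsInclRep R T → IsInclRep R (λ a → inside ∷ T a)
IsInclRep-inside∷ rep a b = ⇔.trans (rep a b) in⊆in-⇔

IsEpsilon⇒≡1 : ∀ {r} {R : Fin r → Fin r → Set} {ε} → IsEpsilon R ε → HasUniqueMinimal R → ε ≡ 1
IsEpsilon⇒≡1 (inj₁ (ε≡1 , _))       _      = ε≡1
IsEpsilon⇒≡1 (inj₂ (_ , ¬hasUnique)) unique = contradiction unique ¬hasUnique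

module _ {q n} {e : Fin q → Subset n} where

  Q'Order-isInclRep : IsInclRep (Q'Order e) e
  Q'Order-isInclRep a b = ⇔.refl

  least⇒HasUniqueMinimal : (∀ a b → e a ≡ e b → a ≡ b) → ∀ {m} → (∀ b → e m ⊆ e b) →
    HasUniqueMinimal (Q'Order e)
  least⇒HasUniqueMinimal injective {m} least = m , minimal , unique
    where
    minimal : IsMinimal (Q'Order e) m
    minimal b b⊆m = injective b m (⊆-antisym b⊆m (least b))
    unique : ∀ b → IsMinimal (Q'Order e) b → b ≡ m
    unique b b-minimal = sym (b-minimal m (least b))

record NonemptyRepresentation {q n} (e : Fin q → Subset n) (bound : ℕ) : Set where
  field
    N         : ℕ
    U         : Fin q → Subset N
    isInclRep : IsInclRep (Q'Order e) U
    size-≤    : ∀ a → ∣ U a ∣ ≤ ∣ e a ∣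
    nonempty  : ∀ a → Nonempty (U a)
    ∣Union∣-≤ : ∣ Union U ∣ ≤ bound

NonemptyRepresentation-weaken : ∀ {q n} {e : Fin q → Subset n} {b b′} → b ≤ b′ →
  NonemptyRepresentation e b → NonemptyRepresentation e b′
NonemptyRepresentation-weaken b≤b′ ρ = record
  { N = N ; U = U ; isInclRep = isInclRep ; size-≤ = size-≤ ; nonempty = nonempty
  ; ∣Union∣-≤ = ≤-trans ∣Union∣-≤ b≤b′
  }
  where open NonemptyRepresentation ρ

module _ {q n} {e : Fin q → Subset n} {k}
  (iir-≤ : ∀ N (U : Fin q → Subset N) → IsInclRep (Q'Order e) U → IsIrreducible (Q'Order e) U →
           ∣ Union U ∣ ≤ k)
  where

  nonemptyRepresentation-least : ∀ {m} → Nonempty (e m) → (∀ b → e m ⊆ e b) →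
    NonemptyRepresentation e (suc k)
  nonemptyRepresentation-least {m} (i , i∈m) least
    with irreducibleReduction (IsInclRep-─ least Q'Order-isInclRep)
  ... | T , repT , irrT , T≤ = record
    { N         = suc n
    ; U         = λ b → inside ∷ T b
    ; isInclRep = IsInclRep-inside∷ repT
    ; size-≤    = λ b → ≤-trans (s≤s (T≤ b)) (p∩q≢∅⇒∣p─q∣<∣p∣ (e b) (e m) (i , x∈p∩q⁺ (least b i∈m , i∈m)))
    ; nonempty  = λ _ → zero , here
    ; ∣Union∣-≤ = ≤-trans (∣Union∣≤ _ λ b → s⊆s (⊆-Union T b)) (s≤s (iir-≤ n T repT irrT))
    }

  nonemptyRepresentation-noLeast : ¬ (∃ λ m → ∀ b → e m ⊆ e b) → NonemptyRepresentation e k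
  nonemptyRepresentation-noLeast noLeast with irreducibleReduction {T₀ = e} (Q'Order-isInclRep {e = e})
  ... | T , repT , irrT , T≤ = record
    { N         = n
    ; U         = T
    ; isInclRep = repT
    ; size-≤    = T≤
    ; nonempty  = nonempty
    ; ∣Union∣-≤ = iir-≤ n T repT irrT
    }
    where
    nonempty : ∀ a → Nonempty (T a)
    nonempty a with nonempty? (T a)
    ... | yes ne    = ne
    ... | no  empty = contradiction (a , least) noLeast
      where
      least : ∀ b → e a ⊆ e b
      least b = from (repT a b) (Empty⇒⊆ empty)

  nonemptyRepresentation : (∀ a b → e a ≡ e b → a ≡ b) → (∀ a → Nonempty (e a)) →
    ∀ {ε} → IsEpsilon (Q'Order e) ε → NonemptyRepresentation e (k + ε)
  nonemptyRepresentation injective nonempty {ε} isε with any? (λ m → all? (λ b → e m ⊆? e b))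
  ... | yes (m , least) =
    NonemptyRepresentation-weaken (≤-reflexive suc-k≡k+ε) (nonemptyRepresentation-least (nonempty m) least)
    where
    ε≡1 : ε ≡ 1
    ε≡1 = IsEpsilon⇒≡1 isε (least⇒HasUniqueMinimal injective least)
    suc-k≡k+ε : suc k ≡ k + ε
    suc-k≡k+ε = trans (+-comm 1 k) (cong (k +_) (sym ε≡1))
  ... | no noLeast = NonemptyRepresentation-weaken (m≤m+n k ε) (nonemptyRepresentation-noLeast noLeast)

IsInclRep-++∩ : ∀ {p} {R : Fin p → Fin p → Set} {n N} {S : Fin p → Subset n} {V : Fin p → Subset N}
  (Y : Subset n) → IsInclRep R S → (∀ x z → V x ⊆ V z ⇔ S x ─ Y ⊆ S z ─ Y) →
  IsInclRep R (λ x → V x ++ S x ∩ Y)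
IsInclRep-++∩ {R = R} {S = S} {V} Y repS V⇔ x z = begin
  R x z                                   ≈⟨ repS x z ⟩
  S x ⊆ S z                               ≈⟨ ⊆⇔─×∩ (S x) (S z) Y ⟩
  (S x ─ Y ⊆ S z ─ Y × S x ∩ Y ⊆ S z ∩ Y) ≈⟨ ⇔.sym (V⇔ x z) ×-⇔ ⇔.refl ⟩
  (V x ⊆ V z × S x ∩ Y ⊆ S z ∩ Y)         ≈⟨ ⇔.sym ++⊆++⇔ ⟩
  V x ++ S x ∩ Y ⊆ V z ++ S z ∩ Y         ∎
  where open SetoidReasoning (⇔.⇔-setoid 0ℓ)

∣Union-++∩∣≤ : ∀ {p n N} (S : Fin p → Subset n) (V : Fin p → Subset N) (Y : Subset n) →
  ∣ Union (λ x → V x ++ S x ∩ Y) ∣ ≤ ∣ Union V ∣ + ∣ Y ∣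
∣Union-++∩∣≤ S V Y = begin
  ∣ Union (λ x → V x ++ S x ∩ Y) ∣ ≤⟨ ∣Union∣≤ _ (λ x → ++⊆++⁺ (⊆-Union V x) (p∩q⊆q (S x) Y)) ⟩
  ∣ Union V ++ Y ∣                 ≡⟨ ∣p++q∣≡∣p∣+∣q∣ (Union V) Y ⟩
  ∣ Union V ∣ + ∣ Y ∣              ∎
  where open ≤-Reasoning

module Outer {p q n} {D : Fin p → Subset n} {e : Fin q → Subset n}
  (cover : ∀ x → Nonempty (D x) → Σ (Fin q) λ a → e a ≡ D x) {b} (ρ : NonemptyRepresentation e b) where
  open NonemptyRepresentation ρ

  outer : Fin p → Subset N
  outer x with nonempty? (D x)
  ... | yes nonempty-Dx = U (proj₁ (cover x nonempty-Dx))
  ... | no  _           = ⊥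

  outer-⊆-⇔ : ∀ x z → outer x ⊆ outer z ⇔ D x ⊆ D z
  outer-⊆-⇔ x z with nonempty? (D x) | nonempty? (D z)
  ... | no empty-Dx | _ = Empty⇒⊆⇔⊆ Empty⊥ empty-Dx
  ... | yes nonempty-Dx | no empty-Dz =
    ¬⇒⇔ (Nonempty⇒⊈Empty (nonempty _) Empty⊥) (Nonempty⇒⊈Empty nonempty-Dx empty-Dz)
  ... | yes nonempty-Dx | yes nonempty-Dz with cover x nonempty-Dx | cover z nonempty-Dz
  ...   | a , ea≡Dx | c , ec≡Dz = subst₂ (λ s t → U a ⊆ U c ⇔ s ⊆ t) ea≡Dx ec≡Dz (⇔.sym (isInclRep a c))

  ∣outer∣≤ : ∀ x → ∣ outer x ∣ ≤ ∣ D x ∣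
  ∣outer∣≤ x with nonempty? (D x)
  ... | no  _ = ≤-trans (≤-reflexive (∣⊥∣≡0 N)) z≤n
  ... | yes nonempty-Dx with cover x nonempty-Dx
  ...   | a , ea≡Dx = ≤-trans (size-≤ a) (≤-reflexive (cong ∣_∣ ea≡Dx))

  ∣Union-outer∣≤ : ∣ Union outer ∣ ≤ b
  ∣Union-outer∣≤ = ≤-trans (∣Union∣≤ outer outer⊆⋃U) ∣Union∣-≤
    where
    outer⊆⋃U : ∀ x → outer x ⊆ Union U
    outer⊆⋃U x with nonempty? (D x)
    ... | yes nonempty-Dx = ⊆-Union U (proj₁ (cover x nonempty-Dx))
    ... | no  _           = ⊥⊆

lemma2p1 : ∀ (p : ℕ) (_≤P_ : Fin p → Fin p → Set) → IsPartialOrder _≡_ _≤P_ →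
    ∀ (n : ℕ) (S : Fin p → Subset n) → IsInclRep _≤P_ S →
    ∀ (y : Fin p) (q : ℕ) (e : Fin q → Subset n) → EnumeratesQ' _≤P_ S y e →
    ∀ (ε : ℕ) → IsEpsilon (Q'Order e) ε →
    ∀ (k : ℕ) → IsIIR (Q'Order e) k →
    Σ ℕ λ n' → Σ (Fin p → Subset n') λ S' →
      IsInclRep _≤P_ S'
      × (∀ (x : Fin p) → ∣ S' x ∣ ≤ ∣ S x ∣)
      × ∣ Union S' ∣ ≤ k + ε + ∣ S y ∣
lemma2p1 p _≤P_ _ n S repS y q e (injective , inQ' , cover) ε isε k (_ , iir-≤) =
  N + n , S′ , IsInclRep-++∩ Y repS outer-⊆-⇔ ,
  (λ x → ∣p++q∩r∣≤∣q∣ (outer x) (S x) Y (∣outer∣≤ x)) , ∣Union-S′∣≤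
  where
  Y : Subset n
  Y = S y
  e-nonempty : ∀ a → Nonempty (e a)
  e-nonempty a with inQ' a
  ... | x , x≰y , ea≡ = subst Nonempty (sym ea≡) (⊈⇒Nonempty─ (x≰y ∘ from (repS x y)))
  cover′ : ∀ x → Nonempty (S x ─ Y) → Σ (Fin q) λ a → e a ≡ S x ─ Y
  cover′ x nonempty = cover x (λ x≤y → ⊆⇒Empty─ (to (repS x y) x≤y) nonempty)
  ρ : NonemptyRepresentation e (k + ε)
  ρ = nonemptyRepresentation iir-≤ injective e-nonempty isε
  open NonemptyRepresentation ρ using (N)
  open Outer cover′ ρ
  S′ : Fin p → Subset (N + n)
  S′ x = outer x ++ S x ∩ Y
  ∣Union-S′∣≤ : ∣ Union S′ ∣ ≤ k + ε + ∣ Y ∣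
  ∣Union-S′∣≤ = ≤-trans (∣Union-++∩∣≤ S outer Y) (+-monoˡ-≤ ∣ Y ∣ ∣Union-outer∣≤)
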